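{- Let $p$ be a prime, let $s\in\mathbb N$, let $m_1,\ldots,m_s$ be positive integers, and let $k_1,\ldots,k_s,n_1,\ldots,n_s$ be nonnegative integers with $k_i\leq n_i$ for all $i$. Write $K=k_1m_1+\cdots+k_sm_s$ and $D=n_1m_1+\cdots+n_sm_s-K$. Then $$\int_{\mathbb Z_p}B_{k_1,n_1}^{m_1}(x)B_{k_2,n_2}^{m_2}(x)\cdots B_{k_s,n_s}^{m_s}(x)\,d\mu_1(x)=\binom{n_1}{k_1}^{m_1}\binom{n_2}{k_2}^{m_2}\cdots\binom{n_s}{k_s}^{m_s}\sum_{l=0}^{D}(-1)^{l}\binom{D}{l}B_{K+l}.$$
   Context: For integers $0\leq k\leq n$, the Bernstein polynomial is $B_{k,n}(x)=\binom{n}{k}x^k(1-x)^{n-k}$, and $B_{k,n}^{m}(x)$ denotes the $m$-fold product $B_{k,n}(x)\cdots B_{k,n}(x)$. $\mathbb Z_p$ denotes the ring of $p$-adic integers, and for a uniformly differentiable $f:\mathbb Z_p\to\mathbb C_p$ the bosonic $p$-adic (Volkenborn) integral is $\int_{\mathbb Z_p}f(x)\,d\mu_1(x)=\lim_{N\to\infty}\frac{1}{p^N}\sum_{x=0}^{p^N-1}f(x)$. $B_m$ denotes the $m$-th Bernoulli number, defined by $\frac{t}{e^t-1}=\sum_{m\geq0}B_m\frac{t^m}{m!}$; one has $\int_{\mathbb Z_p}x^m\,d\mu_1(x)=B_m$. -}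

module Defs where

open import Data.Nat as ℕ using (ℕ; zero; suc; _≤_; NonZero; nonTrivial⇒nonZero)
open import Data.Nat.Properties using (m^n≢0)
open import Data.Nat.Divisibility using (_∣_)
open import Data.Nat.Primality using (Prime; prime)
open import Data.Nat.Combinatorics using (_C_)
open import Data.Integer as ℤ using (ℤ; +_; ∣_∣)
open import Data.Rational as ℚ using (ℚ; 0ℚ; 1ℚ; _+_; _*_; _-_; -_; ↥_)
open import Data.Fin using (Fin; zero; suc)
open import Data.Product using (∃)

ℕ→ℚ : ℕ → ℚ
ℕ→ℚ n = (+ n) ℚ./ 1

_^ℚ_ : ℚ → ℕ → ℚ
q ^ℚ zero  = 1ℚ
q ^ℚ suc n = q * (q ^ℚ n)

Σ< : ℕ → (ℕ → ℚ) → ℚ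
Σ< zero    f = 0ℚ
Σ< (suc n) f = Σ< n f + f n

Σ≤ : ℕ → (ℕ → ℚ) → ℚ
Σ≤ n f = Σ< (suc n) f

ΣFinℕ : (s : ℕ) → (Fin s → ℕ) → ℕ
ΣFinℕ zero    f = 0
ΣFinℕ (suc s) f = f zero ℕ.+ ΣFinℕ s (λ i → f (suc i))

ΠFinℕ : (s : ℕ) → (Fin s → ℕ) → ℕ
ΠFinℕ zero    f = 1
ΠFinℕ (suc s) f = f zero ℕ.* ΠFinℕ s (λ i → f (suc i))

ΠFinℚ : (s : ℕ) → (Fin s → ℚ) → ℚ
ΠFinℚ zero    f = 1ℚ
ΠFinℚ (suc s) f = f zero * ΠFinℚ s (λ i → f (suc i))

-- Bernoulli numbers B_m with t/(e^t - 1) = Σ B_m t^m/m!  (so B_1 = -1/2),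
-- via the standard closed formula
--   B_m = Σ_{k=0}^{m} 1/(k+1) Σ_{j=0}^{k} (-1)^j C(k,j) j^m .
bernoulli : ℕ → ℚ
bernoulli m =
  Σ≤ m (λ k → ((+ 1) ℚ./ suc k) *
    Σ≤ k (λ j → ((- 1ℚ) ^ℚ j) * ℕ→ℚ (k C j) * (ℕ→ℚ j ^ℚ m)))

bernstein : ℕ → ℕ → ℚ → ℚ
bernstein k n x = ℕ→ℚ (n C k) * (x ^ℚ k) * ((1ℚ - x) ^ℚ (n ℕ.∸ k))

invPow : (p : ℕ) → .{{NonZero p}} → ℕ → ℚ
invPow p N = (+ 1) ℚ./ (p ℕ.^ N)
  where instance _ = m^n≢0 p N

volkenbornSum : (p : ℕ) → Prime p → (ℕ → ℚ) → ℕ → ℚ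
volkenbornSum p (prime _) f N = invPow p N * Σ< (p ℕ.^ N) f
  where instance _ = nonTrivial⇒nonZero p

-- p-adic valuation of q is at least e  (q ∈ p^e ℤ_(p)): since ℚ is stored in
-- lowest terms, this is  p^e ∣ numerator(q)  (q = 0 always qualifies).
padicValGE : ℕ → ℕ → ℚ → Set
padicValGE p e q = (p ℕ.^ e) ∣ ∣ ↥ q ∣

PAdicLimit : ℕ → (ℕ → ℚ) → ℚ → Set
PAdicLimit p a L =
  ∀ (e : ℕ) → ∃ λ (N₀ : ℕ) → ∀ (N : ℕ) → N₀ ≤ N → padicValGE p e (a N - L)

-- ∫_{ℤ_p} f dμ₁ = L  for f : ℤ_p → ℚ_p given on ℕ (dense in ℤ_p):
-- the Volkenborn limit  lim_N p^{-N} Σ_{x<p^N} f(x)  exists and equals L.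
VolkenbornIntegral : (p : ℕ) → Prime p → (ℕ → ℚ) → ℚ → Set
VolkenbornIntegral p pp f L = PAdicLimit p (volkenbornSum p pp f) L

{-# OPTIONS --safe #-}
-- Each Bernstein power equals (n C k)^m x^(km) (1-x)^((n-k)m), so the integrand is a constant times
-- x^K (1-x)^D, and peeling off one factor 1-x at a time reduces the claim, by linearity of the
-- Volkenborn limit, to ∫ x^m dμ₁ = B_m.  By Newton's forward-difference formula the N-th Volkenborn
-- sum of x^m is Σ_k C(p^N,k+1)/p^N · Δ^k x^m|₀, while the closed formula defining B_m is
-- Σ_k (-1)^k/(k+1) · Δ^k x^m|₀.  As (k+1)!·C(n,k+1) ≡ (-1)^k k!·n (mod n²), the k-th terms differ by
-- p^N times an integer times a rational independent of N, which tends to 0 p-adically.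
module Submission where

open import Defs
open import Data.Nat as ℕ using (ℕ; zero; suc; _≤_; _<_; _+_; _*_; _∸_; _^_; _!; NonZero; s≤s)
import Data.Nat.Properties as ℕP
open import Data.Nat.Combinatorics using (_C_; nC1≡n; nCk+nC[k+1]≡[n+1]C[k+1])
open import Data.Nat.Divisibility using (_∣_; divides; _∣?_; 1∣_; ∣1⇒≡1; ∣-trans; m∣m*n; *-monoʳ-∣; *-cancelˡ-∣)
open import Data.Nat.Induction using (<-rec)
open import Data.Nat.Primality using (Prime; prime; euclidsLemma; prime⇒nonZero; prime⇒nonTrivial)
open import Data.Nat.Tactic.RingSolver using () renaming (solve-∀ to ℕ-solve-∀)
open import Data.Integer as ℤ using (ℤ; +_)
import Data.Integer.Properties as ℤP
open import Data.Rational as ℚ using (ℚ; 0ℚ; 1ℚ; -_)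
import Data.Rational.Properties as ℚP
import Data.Rational.Unnormalised as ℚᵘ
import Data.Rational.Unnormalised.Properties as ℚᵘP
open import Data.Rational.Solver using (module +-*-Solver)
open import Data.Fin as Fin using (Fin)
open import Data.Product using (∃; _×_; _,_; proj₁; proj₂)
open import Data.Sum using (inj₁; inj₂; [_,_]′)
open import Function using (_∘_)
open import Relation.Nullary using (¬_; yes; no)
open import Data.Empty using (⊥-elim)
open import Relation.Binary.PropositionalEquality
open ≡-Reasoning
open import Algebra.Bundles using (CommutativeRing)
import Algebra.Properties.CommutativeSemiring.Exp (CommutativeRing.commutativeSemiring ℚP.+-*-commutativeRing) as Exp
open import Data.Integer.Tactic.RingSolver using () renaming (solve-∀ to ℤ-solve-∀)

open +-*-Solver using (solve; _:+_; _:*_; _:-_; :-_; _:=_; con)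

-- Embedding ℕ and ℤ into ℚ

ℤ→ℚ : ℤ → ℚ
ℤ→ℚ z = z ℚ./ 1

1/ₙ_ : (d : ℕ) → .{{NonZero d}} → ℚ
1/ₙ d = + 1 ℚ./ d

sign : ℕ → ℚ
sign k = (- 1ℚ) ^ℚ k

fromℚᵘ-homo-+ : ∀ x y → ℚ.fromℚᵘ (x ℚᵘ.+ y) ≡ ℚ.fromℚᵘ x ℚ.+ ℚ.fromℚᵘ y
fromℚᵘ-homo-+ x y = ℚP.toℚᵘ-injective {ℚ.fromℚᵘ (x ℚᵘ.+ y)} {ℚ.fromℚᵘ x ℚ.+ ℚ.fromℚᵘ y}
  (ℚᵘP.≃-trans (ℚP.toℚᵘ-fromℚᵘ _) (ℚᵘP.≃-sym (ℚᵘP.≃-trans (ℚP.toℚᵘ-homo-+ (ℚ.fromℚᵘ x) (ℚ.fromℚᵘ y))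
    (ℚᵘP.+-cong (ℚP.toℚᵘ-fromℚᵘ x) (ℚP.toℚᵘ-fromℚᵘ y)))))

fromℚᵘ-homo-* : ∀ x y → ℚ.fromℚᵘ (x ℚᵘ.* y) ≡ ℚ.fromℚᵘ x ℚ.* ℚ.fromℚᵘ y
fromℚᵘ-homo-* x y = ℚP.toℚᵘ-injective {ℚ.fromℚᵘ (x ℚᵘ.* y)} {ℚ.fromℚᵘ x ℚ.* ℚ.fromℚᵘ y}
  (ℚᵘP.≃-trans (ℚP.toℚᵘ-fromℚᵘ _) (ℚᵘP.≃-sym (ℚᵘP.≃-trans (ℚP.toℚᵘ-homo-* (ℚ.fromℚᵘ x) (ℚ.fromℚᵘ y))
    (ℚᵘP.*-cong (ℚP.toℚᵘ-fromℚᵘ x) (ℚP.toℚᵘ-fromℚᵘ y)))))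

fromℚᵘ-homo‿- : ∀ x → ℚ.fromℚᵘ (ℚᵘ.- x) ≡ - ℚ.fromℚᵘ x
fromℚᵘ-homo‿- x = ℚP.toℚᵘ-injective {ℚ.fromℚᵘ (ℚᵘ.- x)} { - ℚ.fromℚᵘ x}
  (ℚᵘP.≃-trans (ℚP.toℚᵘ-fromℚᵘ _) (ℚᵘP.≃-sym (ℚᵘP.≃-trans (ℚP.toℚᵘ-homo‿- (ℚ.fromℚᵘ x))
    (ℚᵘP.-‿cong (ℚP.toℚᵘ-fromℚᵘ x)))))

ℤ→ℚ-homo-+ : ∀ a b → ℤ→ℚ (a ℤ.+ b) ≡ ℤ→ℚ a ℚ.+ ℤ→ℚ b
ℤ→ℚ-homo-+ a b = trans
  (ℚP.fromℚᵘ-cong {ℚᵘ.mkℚᵘ (a ℤ.+ b) 0} {ℚᵘ.mkℚᵘ a 0 ℚᵘ.+ ℚᵘ.mkℚᵘ b 0} (ℚᵘ.*≡* (cross-multiplied a b)))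
  (fromℚᵘ-homo-+ (ℚᵘ.mkℚᵘ a 0) (ℚᵘ.mkℚᵘ b 0))
  where
  cross-multiplied : ∀ a b → (a ℤ.+ b) ℤ.* (+ 1 ℤ.* + 1) ≡ (a ℤ.* + 1 ℤ.+ b ℤ.* + 1) ℤ.* + 1
  cross-multiplied = ℤ-solve-∀

ℤ→ℚ-homo-* : ∀ a b → ℤ→ℚ (a ℤ.* b) ≡ ℤ→ℚ a ℚ.* ℤ→ℚ b
ℤ→ℚ-homo-* a b = trans
  (ℚP.fromℚᵘ-cong {ℚᵘ.mkℚᵘ (a ℤ.* b) 0} {ℚᵘ.mkℚᵘ a 0 ℚᵘ.* ℚᵘ.mkℚᵘ b 0} (ℚᵘ.*≡* (cross-multiplied a b)))
  (fromℚᵘ-homo-* (ℚᵘ.mkℚᵘ a 0) (ℚᵘ.mkℚᵘ b 0))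
  where
  cross-multiplied : ∀ a b → (a ℤ.* b) ℤ.* (+ 1 ℤ.* + 1) ≡ (a ℤ.* b) ℤ.* + 1
  cross-multiplied = ℤ-solve-∀

ℤ→ℚ-homo‿- : ∀ a → ℤ→ℚ (ℤ.- a) ≡ - ℤ→ℚ a
ℤ→ℚ-homo‿- a = fromℚᵘ-homo‿- (ℚᵘ.mkℚᵘ a 0)

ℤ→ℚ-injective : ∀ {a b} → ℤ→ℚ a ≡ ℤ→ℚ b → a ≡ b
ℤ→ℚ-injective {a} {b} eq with ℚP.fromℚᵘ-injective {ℚᵘ.mkℚᵘ a 0} {ℚᵘ.mkℚᵘ b 0} eq
... | ℚᵘ.*≡* a*1≡b*1 = trans (sym (ℤP.*-identityʳ a)) (trans a*1≡b*1 (ℤP.*-identityʳ b))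

z/d*d≡z : ∀ z d .{{_ : NonZero d}} → (z ℚ./ d) ℚ.* ℕ→ℚ d ≡ ℤ→ℚ z
z/d*d≡z z (suc d) = trans (sym (fromℚᵘ-homo-* (ℚᵘ.mkℚᵘ z d) (ℚᵘ.mkℚᵘ (+ suc d) 0)))
  (ℚP.fromℚᵘ-cong {ℚᵘ.mkℚᵘ z d ℚᵘ.* ℚᵘ.mkℚᵘ (+ suc d) 0} {ℚᵘ.mkℚᵘ z 0} (ℚᵘ.*≡* (cross-multiplied z (+ suc d))))
  where
  cross-multiplied : ∀ z d → (z ℤ.* d) ℤ.* + 1 ≡ z ℤ.* (d ℤ.* + 1)
  cross-multiplied = ℤ-solve-∀

↥q≡q*↧q : ∀ q → ℤ→ℚ (ℚ.↥ q) ≡ q ℚ.* ℕ→ℚ (ℚ.↧ₙ q)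
↥q≡q*↧q q = sym (trans (cong (ℚ._* ℕ→ℚ (ℚ.↧ₙ q)) (sym (ℚP.↥p/↧p≡p q))) (z/d*d≡z (ℚ.↥ q) (ℚ.↧ₙ q)))

1/ₙd*d≡1 : ∀ d .{{_ : NonZero d}} → 1/ₙ d ℚ.* ℕ→ℚ d ≡ 1ℚ
1/ₙd*d≡1 d = z/d*d≡z (+ 1) d

inverse-unique : ∀ {x y c} → x ℚ.* c ≡ 1ℚ → y ℚ.* c ≡ 1ℚ → x ≡ y
inverse-unique {x} {y} {c} xc≡1 yc≡1 = begin
  x                  ≡⟨ sym (ℚP.*-identityʳ x) ⟩
  x ℚ.* 1ℚ           ≡⟨ cong (x ℚ.*_) (sym yc≡1) ⟩
  x ℚ.* (y ℚ.* c)    ≡⟨ solve 3 (λ x y c → x :* (y :* c) := (x :* c) :* y) refl x y c ⟩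
  (x ℚ.* c) ℚ.* y    ≡⟨ cong (ℚ._* y) xc≡1 ⟩
  1ℚ ℚ.* y           ≡⟨ ℚP.*-identityˡ y ⟩
  y                  ∎

ℕ→ℚ-homo-+ : ∀ m n → ℕ→ℚ (m + n) ≡ ℕ→ℚ m ℚ.+ ℕ→ℚ n
ℕ→ℚ-homo-+ m n = ℤ→ℚ-homo-+ (+ m) (+ n)

ℕ→ℚ-homo-* : ∀ m n → ℕ→ℚ (m * n) ≡ ℕ→ℚ m ℚ.* ℕ→ℚ n
ℕ→ℚ-homo-* m n = trans (cong ℤ→ℚ (ℤP.pos-* m n)) (ℤ→ℚ-homo-* (+ m) (+ n))

ℕ→ℚ-homo-^ : ∀ m n → ℕ→ℚ (m ^ n) ≡ ℕ→ℚ m ^ℚ n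
ℕ→ℚ-homo-^ m zero    = refl
ℕ→ℚ-homo-^ m (suc n) = trans (ℕ→ℚ-homo-* m (m ^ n)) (cong (ℕ→ℚ m ℚ.*_) (ℕ→ℚ-homo-^ m n))

^ℚ≡^ : ∀ x n → x ^ℚ n ≡ x Exp.^ n
^ℚ≡^ x zero    = refl
^ℚ≡^ x (suc n) = cong (x ℚ.*_) (^ℚ≡^ x n)

^ℚ-homo-+ : ∀ x m n → x ^ℚ (m + n) ≡ x ^ℚ m ℚ.* x ^ℚ n
^ℚ-homo-+ x m n rewrite ^ℚ≡^ x (m + n) | ^ℚ≡^ x m | ^ℚ≡^ x n = Exp.^-homo-* x m n

^ℚ-distrib-* : ∀ x y n → (x ℚ.* y) ^ℚ n ≡ x ^ℚ n ℚ.* y ^ℚ n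
^ℚ-distrib-* x y n rewrite ^ℚ≡^ (x ℚ.* y) n | ^ℚ≡^ x n | ^ℚ≡^ y n = Exp.^-distrib-* x y n

^ℚ-assocʳ : ∀ x m n → (x ^ℚ m) ^ℚ n ≡ x ^ℚ (m * n)
^ℚ-assocʳ x m n rewrite ^ℚ≡^ (x ^ℚ m) n | ^ℚ≡^ x m | ^ℚ≡^ x (m * n) = Exp.^-assocʳ x m n

IsInteger : ℚ → Set
IsInteger q = ∃ λ z → ℤ→ℚ z ≡ q

isInteger-ℕ : ∀ n → IsInteger (ℕ→ℚ n)
isInteger-ℕ n = + n , refl

isInteger-+ : ∀ {q r} → IsInteger q → IsInteger r → IsInteger (q ℚ.+ r)
isInteger-+ (a , refl) (b , refl) = a ℤ.+ b , ℤ→ℚ-homo-+ a b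

isInteger-* : ∀ {q r} → IsInteger q → IsInteger r → IsInteger (q ℚ.* r)
isInteger-* (a , refl) (b , refl) = a ℤ.* b , ℤ→ℚ-homo-* a b

isInteger-neg : ∀ {q} → IsInteger q → IsInteger (- q)
isInteger-neg (a , refl) = ℤ.- a , ℤ→ℚ-homo‿- a

isInteger-sub : ∀ {q r} → IsInteger q → IsInteger r → IsInteger (q ℚ.- r)
isInteger-sub q∈ℤ r∈ℤ = isInteger-+ q∈ℤ (isInteger-neg r∈ℤ)

isInteger-sign : ∀ k → IsInteger (sign k)
isInteger-sign zero    = isInteger-ℕ 1
isInteger-sign (suc k) = isInteger-* (isInteger-neg (isInteger-ℕ 1)) (isInteger-sign k)

-- Finite sums and binomial coefficients

Σ<-cong : ∀ n {f g : ℕ → ℚ} → (∀ i → f i ≡ g i) → Σ< n f ≡ Σ< n g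
Σ<-cong zero    f≗g = refl
Σ<-cong (suc n) f≗g = cong₂ ℚ._+_ (Σ<-cong n f≗g) (f≗g n)

Σ<-+ : ∀ n (f g : ℕ → ℚ) → Σ< n (λ i → f i ℚ.+ g i) ≡ Σ< n f ℚ.+ Σ< n g
Σ<-+ zero    f g = refl
Σ<-+ (suc n) f g = trans (cong (ℚ._+ (f n ℚ.+ g n)) (Σ<-+ n f g))
  (solve 4 (λ a b c d → (a :+ b) :+ (c :+ d) := (a :+ c) :+ (b :+ d)) refl (Σ< n f) (Σ< n g) (f n) (g n))

Σ<-*ˡ : ∀ n c (f : ℕ → ℚ) → Σ< n (λ i → c ℚ.* f i) ≡ c ℚ.* Σ< n f
Σ<-*ˡ zero    c f = sym (ℚP.*-zeroʳ c)
Σ<-*ˡ (suc n) c f = trans (cong (ℚ._+ c ℚ.* f n) (Σ<-*ˡ n c f)) (sym (ℚP.*-distribˡ-+ c (Σ< n f) (f n)))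

Σ<-neg : ∀ n (f : ℕ → ℚ) → Σ< n (λ i → - f i) ≡ - Σ< n f
Σ<-neg zero    f = refl
Σ<-neg (suc n) f = trans (cong (ℚ._+ - f n) (Σ<-neg n f)) (sym (ℚP.neg-distrib-+ (Σ< n f) (f n)))

Σ<-sub : ∀ n (f g : ℕ → ℚ) → Σ< n (λ i → f i ℚ.- g i) ≡ Σ< n f ℚ.- Σ< n g
Σ<-sub n f g = trans (Σ<-+ n f (λ i → - g i)) (cong (Σ< n f ℚ.+_) (Σ<-neg n g))

Σ<-head : ∀ n (f : ℕ → ℚ) → Σ< (suc n) f ≡ f 0 ℚ.+ Σ< n (f ∘ suc)
Σ<-head zero    f = trans (ℚP.+-identityˡ (f 0)) (sym (ℚP.+-identityʳ (f 0)))
Σ<-head (suc n) f = trans (cong (ℚ._+ f (suc n)) (Σ<-head n f)) (ℚP.+-assoc (f 0) _ _)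

Σ<-truncate : ∀ {a b} (f : ℕ → ℚ) → a ℕ.≤′ b → (∀ k → a ≤ k → f k ≡ 0ℚ) → Σ< b f ≡ Σ< a f
Σ<-truncate f ℕ.≤′-refl vanish = refl
Σ<-truncate {a} {suc b} f (ℕ.≤′-step a≤′b) vanish = begin
  Σ< b f ℚ.+ f b  ≡⟨ cong₂ ℚ._+_ (Σ<-truncate f a≤′b vanish) (vanish b (ℕP.≤′⇒≤ a≤′b)) ⟩
  Σ< a f ℚ.+ 0ℚ   ≡⟨ ℚP.+-identityʳ (Σ< a f) ⟩
  Σ< a f          ∎

n<k⇒nCk≡0 : ∀ {n k} → n < k → n C k ≡ 0
n<k⇒nCk≡0 {zero}  {suc k} _         = refl
n<k⇒nCk≡0 {suc n} {suc k} (s≤s n<k) = trans (sym (nCk+nC[k+1]≡[n+1]C[k+1] n k))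
  (cong₂ _+_ (n<k⇒nCk≡0 n<k) (n<k⇒nCk≡0 (ℕP.m<n⇒m<1+n n<k)))

pascal-ℚ : ∀ n k → ℕ→ℚ (suc n C suc k) ≡ ℕ→ℚ (n C k) ℚ.+ ℕ→ℚ (n C suc k)
pascal-ℚ n k = trans (cong ℕ→ℚ (sym (nCk+nC[k+1]≡[n+1]C[k+1] n k))) (ℕ→ℚ-homo-+ (n C k) (n C suc k))

Σ≤-pascal : ∀ n (c : ℕ → ℚ) →
  Σ≤ (suc n) (λ k → ℕ→ℚ (suc n C k) ℚ.* c k)
    ≡ Σ≤ n (λ k → ℕ→ℚ (n C k) ℚ.* c k) ℚ.+ Σ≤ n (λ k → ℕ→ℚ (n C k) ℚ.* c (suc k))
Σ≤-pascal n c = begin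
  Σ≤ (suc n) (λ k → ℕ→ℚ (suc n C k) ℚ.* c k)
    ≡⟨ Σ<-head (suc n) _ ⟩
  c₀ ℚ.+ Σ< (suc n) (λ k → ℕ→ℚ (suc n C suc k) ℚ.* c (suc k))
    ≡⟨ cong (c₀ ℚ.+_) (trans (Σ<-cong (suc n) split) (Σ<-+ (suc n) _ _)) ⟩
  c₀ ℚ.+ (B ℚ.+ Σ< (suc n) h)
    ≡⟨ cong (λ z → c₀ ℚ.+ (B ℚ.+ z)) (Σ<-truncate h (ℕ.≤′-step ℕ.≤′-refl) h-vanish) ⟩
  c₀ ℚ.+ (B ℚ.+ Σ< n h)
    ≡⟨ solve 3 (λ a b c → a :+ (b :+ c) := (a :+ c) :+ b) refl c₀ B (Σ< n h) ⟩
  (c₀ ℚ.+ Σ< n h) ℚ.+ B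
    ≡⟨ cong (ℚ._+ B) (sym (Σ<-head n _)) ⟩
  Σ≤ n (λ k → ℕ→ℚ (n C k) ℚ.* c k) ℚ.+ B
    ∎
  where
  c₀ = ℕ→ℚ 1 ℚ.* c 0
  B = Σ≤ n (λ k → ℕ→ℚ (n C k) ℚ.* c (suc k))
  h : ℕ → ℚ
  h k = ℕ→ℚ (n C suc k) ℚ.* c (suc k)
  split : ∀ k → ℕ→ℚ (suc n C suc k) ℚ.* c (suc k) ≡ ℕ→ℚ (n C k) ℚ.* c (suc k) ℚ.+ h k
  split k = trans (cong (ℚ._* c (suc k)) (pascal-ℚ n k)) (ℚP.*-distribʳ-+ (c (suc k)) (ℕ→ℚ (n C k)) (ℕ→ℚ (n C suc k)))
  h-vanish : ∀ k → n ≤ k → h k ≡ 0ℚ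
  h-vanish k n≤k = trans (cong (λ m → ℕ→ℚ m ℚ.* c (suc k)) (n<k⇒nCk≡0 (s≤s n≤k))) (ℚP.*-zeroˡ (c (suc k)))

nC[1+k]*[1+k]+nCk*k≡nCk*n : ∀ n k → (n C suc k) * suc k + (n C k) * k ≡ (n C k) * n
nC[1+k]*[1+k]+nCk*k≡nCk*n zero    zero    = refl
nC[1+k]*[1+k]+nCk*k≡nCk*n zero    (suc k) = sym (ℕP.*-zeroʳ (0 C suc k))
nC[1+k]*[1+k]+nCk*k≡nCk*n (suc n) zero    rewrite nC1≡n (suc n) = units n
  where
  units : ∀ n → suc n * 1 + 0 ≡ 1 * suc n
  units = ℕ-solve-∀
nC[1+k]*[1+k]+nCk*k≡nCk*n (suc n) (suc k) = begin
  (suc n C (2 + k)) * (2 + k) + (suc n C suc k) * suc k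
    ≡⟨ cong₂ (λ x y → x * (2 + k) + y * suc k)
         (sym (nCk+nC[k+1]≡[n+1]C[k+1] n (suc k))) (sym (nCk+nC[k+1]≡[n+1]C[k+1] n k)) ⟩
  (b + c) * (2 + k) + (a + b) * suc k
    ≡⟨ regroup a b c k ⟩
  (c * (2 + k) + b * suc k) + (b * suc k + a * k) + (a + b)
    ≡⟨ cong₂ (λ x y → x + y + (a + b))
         (nC[1+k]*[1+k]+nCk*k≡nCk*n n (suc k)) (nC[1+k]*[1+k]+nCk*k≡nCk*n n k) ⟩
  b * n + a * n + (a + b)
    ≡⟨ factor a b n ⟩
  (a + b) * suc n
    ≡⟨ cong (_* suc n) (nCk+nC[k+1]≡[n+1]C[k+1] n k) ⟩
  (suc n C suc k) * suc n
    ∎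
  where
  a = n C k
  b = n C suc k
  c = n C (2 + k)
  regroup : ∀ a b c k → (b + c) * (2 + k) + (a + b) * suc k
                      ≡ (c * (2 + k) + b * suc k) + (b * suc k + a * k) + (a + b)
  regroup = ℕ-solve-∀
  factor : ∀ a b n → b * n + a * n + (a + b) ≡ (a + b) * suc n
  factor = ℕ-solve-∀

nC[1+k]*[1+k]≡nCk*[n-k] : ∀ n k → ℕ→ℚ (n C suc k) ℚ.* ℕ→ℚ (suc k) ≡ ℕ→ℚ (n C k) ℚ.* (ℕ→ℚ n ℚ.- ℕ→ℚ k)
nC[1+k]*[1+k]≡nCk*[n-k] n k = begin
  X                              ≡⟨ solve 2 (λ x y → x := (x :+ y) :- y) refl X Y ⟩
  (X ℚ.+ Y) ℚ.- Y                ≡⟨ cong (ℚ._- Y) cast ⟩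
  ℕ→ℚ (n C k) ℚ.* ℕ→ℚ n ℚ.- Y
    ≡⟨ solve 3 (λ c n k → c :* n :- c :* k := c :* (n :- k)) refl (ℕ→ℚ (n C k)) (ℕ→ℚ n) (ℕ→ℚ k) ⟩
  ℕ→ℚ (n C k) ℚ.* (ℕ→ℚ n ℚ.- ℕ→ℚ k) ∎
  where
  X = ℕ→ℚ (n C suc k) ℚ.* ℕ→ℚ (suc k)
  Y = ℕ→ℚ (n C k) ℚ.* ℕ→ℚ k
  cast : X ℚ.+ Y ≡ ℕ→ℚ (n C k) ℚ.* ℕ→ℚ n
  cast = begin
    X ℚ.+ Y
      ≡⟨ sym (cong₂ ℚ._+_ (ℕ→ℚ-homo-* (n C suc k) (suc k)) (ℕ→ℚ-homo-* (n C k) k)) ⟩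
    ℕ→ℚ ((n C suc k) * suc k) ℚ.+ ℕ→ℚ ((n C k) * k)
      ≡⟨ sym (ℕ→ℚ-homo-+ ((n C suc k) * suc k) ((n C k) * k)) ⟩
    ℕ→ℚ ((n C suc k) * suc k + (n C k) * k)
      ≡⟨ cong ℕ→ℚ (nC[1+k]*[1+k]+nCk*k≡nCk*n n k) ⟩
    ℕ→ℚ ((n C k) * n)
      ≡⟨ ℕ→ℚ-homo-* (n C k) n ⟩
    ℕ→ℚ (n C k) ℚ.* ℕ→ℚ n
      ∎

-- (k+1)!·C(n,k+1) = n(n-1)⋯(n-k) ≡ (-1)^k k!·n  (mod n²)
binomial-congruence : ∀ n k → ∃ λ w → IsInteger w ×
  ℕ→ℚ (n C suc k) ℚ.* ℕ→ℚ (suc k !) ≡ ℕ→ℚ n ℚ.* (sign k ℚ.* ℕ→ℚ (k !) ℚ.+ ℕ→ℚ n ℚ.* w)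
binomial-congruence n zero = 0ℚ , isInteger-ℕ 0 , eq
  where
  eq : ℕ→ℚ (n C 1) ℚ.* ℕ→ℚ 1 ≡ ℕ→ℚ n ℚ.* (1ℚ ℚ.* ℕ→ℚ 1 ℚ.+ ℕ→ℚ n ℚ.* 0ℚ)
  eq rewrite nC1≡n n = solve 1 (λ x → x :* con 1ℚ := x :* (con 1ℚ :* con 1ℚ :+ x :* con 0ℚ)) refl (ℕ→ℚ n)
binomial-congruence n (suc k) = w′ , w′∈ℤ , eq′
  where
  w   = proj₁ (binomial-congruence n k)
  w∈ℤ = proj₁ (proj₂ (binomial-congruence n k))
  eq  = proj₂ (proj₂ (binomial-congruence n k))
  N  = ℕ→ℚ n
  K₁ = ℕ→ℚ (suc k)
  F  = ℕ→ℚ (k !)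
  F₁ = ℕ→ℚ (suc k !)
  w′ = sign k ℚ.* F ℚ.+ w ℚ.* (N ℚ.- K₁)
  w′∈ℤ : IsInteger w′
  w′∈ℤ = isInteger-+ (isInteger-* (isInteger-sign k) (isInteger-ℕ (k !)))
                     (isInteger-* w∈ℤ (isInteger-sub (isInteger-ℕ n) (isInteger-ℕ (suc k))))
  eq′ : ℕ→ℚ (n C suc (suc k)) ℚ.* ℕ→ℚ (suc (suc k) !) ≡ N ℚ.* (sign (suc k) ℚ.* F₁ ℚ.+ N ℚ.* w′)
  eq′ = begin
    ℕ→ℚ (n C suc (suc k)) ℚ.* ℕ→ℚ (suc (suc k) !)
      ≡⟨ cong (ℕ→ℚ (n C suc (suc k)) ℚ.*_) (ℕ→ℚ-homo-* (suc (suc k)) (suc k !)) ⟩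
    ℕ→ℚ (n C suc (suc k)) ℚ.* (ℕ→ℚ (suc (suc k)) ℚ.* F₁)
      ≡⟨ sym (ℚP.*-assoc (ℕ→ℚ (n C suc (suc k))) (ℕ→ℚ (suc (suc k))) F₁) ⟩
    ℕ→ℚ (n C suc (suc k)) ℚ.* ℕ→ℚ (suc (suc k)) ℚ.* F₁
      ≡⟨ cong (ℚ._* F₁) (nC[1+k]*[1+k]≡nCk*[n-k] n (suc k)) ⟩
    ℕ→ℚ (n C suc k) ℚ.* (N ℚ.- K₁) ℚ.* F₁
      ≡⟨ solve 3 (λ c d f → c :* d :* f := c :* f :* d) refl (ℕ→ℚ (n C suc k)) (N ℚ.- K₁) F₁ ⟩
    ℕ→ℚ (n C suc k) ℚ.* F₁ ℚ.* (N ℚ.- K₁)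
      ≡⟨ cong (ℚ._* (N ℚ.- K₁)) eq ⟩
    N ℚ.* (sign k ℚ.* F ℚ.+ N ℚ.* w) ℚ.* (N ℚ.- K₁)
      ≡⟨ solve 5 (λ N s F w K₁ → N :* (s :* F :+ N :* w) :* (N :- K₁)
                   := N :* ((con (- 1ℚ) :* s) :* (K₁ :* F) :+ N :* (s :* F :+ w :* (N :- K₁))))
           refl N (sign k) F w K₁ ⟩
    N ℚ.* (sign (suc k) ℚ.* (K₁ ℚ.* F) ℚ.+ N ℚ.* w′)
      ≡⟨ cong (λ x → N ℚ.* (sign (suc k) ℚ.* x ℚ.+ N ℚ.* w′)) (sym (ℕ→ℚ-homo-* (suc k) (k !))) ⟩
    N ℚ.* (sign (suc k) ℚ.* F₁ ℚ.+ N ℚ.* w′)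
      ∎

-- Finite differences

Δ : (ℕ → ℚ) → ℕ → ℚ
Δ f x = f (suc x) ℚ.- f x

Δ^ : ℕ → (ℕ → ℚ) → ℕ → ℚ
Δ^ zero    f = f
Δ^ (suc k) f = Δ (Δ^ k f)

Δ^-cong : ∀ k {f g : ℕ → ℚ} → (∀ x → f x ≡ g x) → ∀ x → Δ^ k f x ≡ Δ^ k g x
Δ^-cong zero    f≗g x = f≗g x
Δ^-cong (suc k) f≗g x = cong₂ ℚ._-_ (Δ^-cong k f≗g (suc x)) (Δ^-cong k f≗g x)

Δ^-shift : ∀ k (f : ℕ → ℚ) x → Δ^ k (f ∘ suc) x ≡ Δ^ k f (suc x)
Δ^-shift zero    f x = refl
Δ^-shift (suc k) f x = cong₂ ℚ._-_ (Δ^-shift k f (suc x)) (Δ^-shift k f x)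

Δ^-Δ : ∀ k (f : ℕ → ℚ) x → Δ^ k (Δ f) x ≡ Δ^ (suc k) f x
Δ^-Δ zero    f x = refl
Δ^-Δ (suc k) f x = cong₂ ℚ._-_ (Δ^-Δ k f (suc x)) (Δ^-Δ k f x)

newton : ∀ n (f : ℕ → ℚ) → f n ≡ Σ≤ n (λ k → ℕ→ℚ (n C k) ℚ.* Δ^ k f 0)
newton zero    f = sym (trans (ℚP.+-identityˡ _) (ℚP.*-identityˡ (f 0)))
newton (suc n) f = begin
  f (suc n)
    ≡⟨ newton n (f ∘ suc) ⟩
  Σ≤ n (λ k → ℕ→ℚ (n C k) ℚ.* Δ^ k (f ∘ suc) 0)
    ≡⟨ Σ<-cong (suc n) (λ k → trans (cong (ℕ→ℚ (n C k) ℚ.*_) (step k))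
                                     (ℚP.*-distribˡ-+ (ℕ→ℚ (n C k)) _ _)) ⟩
  Σ≤ n (λ k → ℕ→ℚ (n C k) ℚ.* Δ^ k f 0 ℚ.+ ℕ→ℚ (n C k) ℚ.* Δ^ (suc k) f 0)
    ≡⟨ Σ<-+ (suc n) _ _ ⟩
  Σ≤ n (λ k → ℕ→ℚ (n C k) ℚ.* Δ^ k f 0) ℚ.+ Σ≤ n (λ k → ℕ→ℚ (n C k) ℚ.* Δ^ (suc k) f 0)
    ≡⟨ sym (Σ≤-pascal n (λ k → Δ^ k f 0)) ⟩
  Σ≤ (suc n) (λ k → ℕ→ℚ (suc n C k) ℚ.* Δ^ k f 0)
    ∎
  where
  step : ∀ k → Δ^ k (f ∘ suc) 0 ≡ Δ^ k f 0 ℚ.+ Δ^ (suc k) f 0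
  step k = trans (Δ^-shift k f 0) (solve 2 (λ a b → b := a :+ (b :- a)) refl (Δ^ k f 0) (Δ^ k f 1))

Σ<-newton : ∀ n (f : ℕ → ℚ) → Σ< n f ≡ Σ< n (λ k → ℕ→ℚ (n C suc k) ℚ.* Δ^ k f 0)
Σ<-newton n f = begin
  S n
    ≡⟨ newton n S ⟩
  Σ≤ n (λ k → ℕ→ℚ (n C k) ℚ.* Δ^ k S 0)
    ≡⟨ Σ<-head n _ ⟩
  ℕ→ℚ 1 ℚ.* 0ℚ ℚ.+ Σ< n (λ k → ℕ→ℚ (n C suc k) ℚ.* Δ^ (suc k) S 0)
    ≡⟨ ℚP.+-identityˡ _ ⟩
  Σ< n (λ k → ℕ→ℚ (n C suc k) ℚ.* Δ^ (suc k) S 0)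
    ≡⟨ Σ<-cong n (λ k → cong (ℕ→ℚ (n C suc k) ℚ.*_) (trans (sym (Δ^-Δ k S 0)) (Δ^-cong k ΔS≗f 0))) ⟩
  Σ< n (λ k → ℕ→ℚ (n C suc k) ℚ.* Δ^ k f 0)
    ∎
  where
  S : ℕ → ℚ
  S x = Σ< x f
  ΔS≗f : ∀ x → Δ S x ≡ f x
  ΔS≗f x = solve 2 (λ s y → (s :+ y) :- s := y) refl (S x) (f x)

altBinomSum : ℕ → (ℕ → ℚ) → ℚ
altBinomSum k f = Σ≤ k (λ j → sign j ℚ.* ℕ→ℚ (k C j) ℚ.* f j)

altBinomSum-suc : ∀ k (f : ℕ → ℚ) → altBinomSum (suc k) f ≡ altBinomSum k f ℚ.- altBinomSum k (f ∘ suc)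
altBinomSum-suc k f = begin
  altBinomSum (suc k) f
    ≡⟨ Σ<-cong (2 + k) (λ j → reorder (sign j) (ℕ→ℚ (suc k C j)) (f j)) ⟩
  Σ≤ (suc k) (λ j → ℕ→ℚ (suc k C j) ℚ.* (sign j ℚ.* f j))
    ≡⟨ Σ≤-pascal k (λ j → sign j ℚ.* f j) ⟩
  Σ≤ k (λ j → ℕ→ℚ (k C j) ℚ.* (sign j ℚ.* f j)) ℚ.+ Σ≤ k (λ j → ℕ→ℚ (k C j) ℚ.* (sign (suc j) ℚ.* f (suc j)))
    ≡⟨ cong₂ ℚ._+_ (Σ<-cong (suc k) (λ j → sym (reorder (sign j) (ℕ→ℚ (k C j)) (f j))))
                   (trans (Σ<-cong (suc k) (λ j → negate (sign j) (ℕ→ℚ (k C j)) (f (suc j))))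
                          (Σ<-neg (suc k) _)) ⟩
  altBinomSum k f ℚ.- altBinomSum k (f ∘ suc)
    ∎
  where
  reorder : ∀ s c x → s ℚ.* c ℚ.* x ≡ c ℚ.* (s ℚ.* x)
  reorder = solve 3 (λ s c x → s :* c :* x := c :* (s :* x)) refl
  negate : ∀ s c x → c ℚ.* ((- 1ℚ) ℚ.* s ℚ.* x) ≡ - (s ℚ.* c ℚ.* x)
  negate = solve 3 (λ s c x → c :* (con (- 1ℚ) :* s :* x) := :- (s :* c :* x)) refl

altBinomSum≡sign*Δ^ : ∀ k (f : ℕ → ℚ) → altBinomSum k f ≡ sign k ℚ.* Δ^ k f 0
altBinomSum≡sign*Δ^ zero    f = ℚP.+-identityˡ _
altBinomSum≡sign*Δ^ (suc k) f = begin
  altBinomSum (suc k) f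
    ≡⟨ altBinomSum-suc k f ⟩
  altBinomSum k f ℚ.- altBinomSum k (f ∘ suc)
    ≡⟨ cong₂ ℚ._-_ (altBinomSum≡sign*Δ^ k f)
                   (trans (altBinomSum≡sign*Δ^ k (f ∘ suc)) (cong (sign k ℚ.*_) (Δ^-shift k f 0))) ⟩
  sign k ℚ.* Δ^ k f 0 ℚ.- sign k ℚ.* Δ^ k f 1
    ≡⟨ solve 3 (λ s a b → s :* a :- s :* b := (con (- 1ℚ) :* s) :* (b :- a)) refl (sign k) (Δ^ k f 0) (Δ^ k f 1) ⟩
  sign (suc k) ℚ.* Δ^ (suc k) f 0
    ∎

Degree≤ : ℕ → (ℕ → ℚ) → Set
Degree≤ zero    f = ∀ x → f x ≡ f 0
Degree≤ (suc d) f = Degree≤ d (Δ f)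

Degree≤-cong : ∀ d {f g : ℕ → ℚ} → (∀ x → f x ≡ g x) → Degree≤ d f → Degree≤ d g
Degree≤-cong zero    f≗g const x = trans (sym (f≗g x)) (trans (const x) (f≗g 0))
Degree≤-cong (suc d) f≗g deg     = Degree≤-cong d (λ x → cong₂ ℚ._-_ (f≗g (suc x)) (f≗g x)) deg

Degree≤-shift : ∀ d (f : ℕ → ℚ) → Degree≤ d f → Degree≤ d (f ∘ suc)
Degree≤-shift zero    f const x = trans (const (suc x)) (sym (const 1))
Degree≤-shift (suc d) f deg     = Degree≤-shift d (Δ f) deg

Degree≤-+ : ∀ d (f g : ℕ → ℚ) → Degree≤ d f → Degree≤ d g → Degree≤ d (λ x → f x ℚ.+ g x)
Degree≤-+ zero    f g f-const g-const x = cong₂ ℚ._+_ (f-const x) (g-const x)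
Degree≤-+ (suc d) f g f-deg g-deg =
  Degree≤-cong d (λ x → Δ-+ (f (suc x)) (g (suc x)) (f x) (g x)) (Degree≤-+ d (Δ f) (Δ g) f-deg g-deg)
  where
  Δ-+ : ∀ a b c e → (a ℚ.- c) ℚ.+ (b ℚ.- e) ≡ (a ℚ.+ b) ℚ.- (c ℚ.+ e)
  Δ-+ = solve 4 (λ a b c e → (a :- c) :+ (b :- e) := (a :+ b) :- (c :+ e)) refl

Δ-x* : ∀ (g : ℕ → ℚ) y → Δ (λ x → ℕ→ℚ x ℚ.* g x) y ≡ ℕ→ℚ y ℚ.* Δ g y ℚ.+ g (suc y)
Δ-x* g y = begin
  ℕ→ℚ (1 + y) ℚ.* g (suc y) ℚ.- ℕ→ℚ y ℚ.* g y
    ≡⟨ cong (λ z → z ℚ.* g (suc y) ℚ.- ℕ→ℚ y ℚ.* g y) (ℕ→ℚ-homo-+ 1 y) ⟩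
  (1ℚ ℚ.+ ℕ→ℚ y) ℚ.* g (suc y) ℚ.- ℕ→ℚ y ℚ.* g y
    ≡⟨ solve 3 (λ y u v → (con 1ℚ :+ y) :* u :- y :* v := y :* (u :- v) :+ u) refl (ℕ→ℚ y) (g (suc y)) (g y) ⟩
  ℕ→ℚ y ℚ.* Δ g y ℚ.+ g (suc y)
    ∎

Degree≤-x* : ∀ d (g : ℕ → ℚ) → Degree≤ d g → Degree≤ (suc d) (λ x → ℕ→ℚ x ℚ.* g x)
Degree≤-x* zero g const y = trans (Δ-x*≡g0 y) (sym (Δ-x*≡g0 0))
  where
  Δ-x*≡g0 : ∀ y → Δ (λ x → ℕ→ℚ x ℚ.* g x) y ≡ g 0
  Δ-x*≡g0 y = begin
    Δ (λ x → ℕ→ℚ x ℚ.* g x) y                        ≡⟨ Δ-x* g y ⟩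
    ℕ→ℚ y ℚ.* (g (suc y) ℚ.- g y) ℚ.+ g (suc y)
      ≡⟨ cong₂ (λ u v → ℕ→ℚ y ℚ.* (u ℚ.- v) ℚ.+ u) (const (suc y)) (const y) ⟩
    ℕ→ℚ y ℚ.* (g 0 ℚ.- g 0) ℚ.+ g 0                 ≡⟨ solve 2 (λ y c → y :* (c :- c) :+ c := c) refl (ℕ→ℚ y) (g 0) ⟩
    g 0                                             ∎
Degree≤-x* (suc d) g deg =
  Degree≤-cong (suc d) (λ y → sym (Δ-x* g y))
    (Degree≤-+ (suc d) (λ y → ℕ→ℚ y ℚ.* Δ g y) (g ∘ suc) (Degree≤-x* d (Δ g) deg) (Degree≤-shift (suc d) g deg))

Degree≤-^ : ∀ m → Degree≤ m (λ x → ℕ→ℚ x ^ℚ m)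
Degree≤-^ zero    x = refl
Degree≤-^ (suc m) = Degree≤-x* m (λ x → ℕ→ℚ x ^ℚ m) (Degree≤-^ m)

Degree≤⇒Δ^≡0 : ∀ d (f : ℕ → ℚ) → Degree≤ d f → ∀ {k} → d < k → ∀ x → Δ^ k f x ≡ 0ℚ
Degree≤⇒Δ^≡0 d f deg d<k = vanish-above (ℕP.≤⇒≤′ d<k)
  where
  Δ^[1+d]≡0 : ∀ d (f : ℕ → ℚ) → Degree≤ d f → ∀ x → Δ^ (suc d) f x ≡ 0ℚ
  Δ^[1+d]≡0 zero    f const x = trans (cong₂ ℚ._-_ (const (suc x)) (const x)) (ℚP.+-inverseʳ (f 0))
  Δ^[1+d]≡0 (suc d) f deg   x = trans (sym (Δ^-Δ (suc d) f x)) (Δ^[1+d]≡0 d (Δ f) deg x)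
  vanish-above : ∀ {k} → suc d ℕ.≤′ k → ∀ x → Δ^ k f x ≡ 0ℚ
  vanish-above ℕ.≤′-refl         = Δ^[1+d]≡0 d f deg
  vanish-above (ℕ.≤′-step d<′k) x = cong₂ ℚ._-_ (vanish-above d<′k (suc x)) (vanish-above d<′k x)

-- Power sums and Bernoulli numbers

1/[_!] : ℕ → ℚ
1/[ k !] = 1/ₙ_ (k !) {{k ℕP.!≢0}}

binomial-ratio : ∀ n .{{_ : NonZero n}} k → ∃ λ w → IsInteger w ×
  1/ₙ n ℚ.* ℕ→ℚ (n C suc k) ℚ.- sign k ℚ.* 1/ₙ suc k ≡ ℕ→ℚ n ℚ.* w ℚ.* 1/[ suc k !]
binomial-ratio n k = w , w∈ℤ , (begin
  1/ₙ n ℚ.* B ℚ.- s ℚ.* a          ≡⟨ cong (ℚ._- s ℚ.* a) 1/n*B≡s*a+N*w*f ⟩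
  s ℚ.* a ℚ.+ N ℚ.* w ℚ.* f ℚ.- s ℚ.* a ≡⟨ solve 2 (λ x y → x :+ y :- x := y) refl (s ℚ.* a) (N ℚ.* w ℚ.* f) ⟩
  N ℚ.* w ℚ.* f                    ∎)
  where
  w   = proj₁ (binomial-congruence n k)
  w∈ℤ = proj₁ (proj₂ (binomial-congruence n k))
  B*F≡N*[sK+Nw] = proj₂ (proj₂ (binomial-congruence n k))
  N = ℕ→ℚ n
  B = ℕ→ℚ (n C suc k)
  F = ℕ→ℚ (suc k !)
  K = ℕ→ℚ (k !)
  f = 1/[ suc k !]
  s = sign k
  a = 1/ₙ suc k
  F*f≡1 : F ℚ.* f ≡ 1ℚ
  F*f≡1 = trans (ℚP.*-comm F f) (1/ₙd*d≡1 (suc k !) {{suc k ℕP.!≢0}})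
  K*f≡a : K ℚ.* f ≡ a
  K*f≡a = inverse-unique (begin
    K ℚ.* f ℚ.* ℕ→ℚ (suc k)      ≡⟨ solve 3 (λ K f k → K :* f :* k := (k :* K) :* f) refl K f (ℕ→ℚ (suc k)) ⟩
    ℕ→ℚ (suc k) ℚ.* K ℚ.* f      ≡⟨ cong (ℚ._* f) (sym (ℕ→ℚ-homo-* (suc k) (k !))) ⟩
    F ℚ.* f                      ≡⟨ F*f≡1 ⟩
    1ℚ                           ∎) (1/ₙd*d≡1 (suc k))
  1/n*B≡s*a+N*w*f : 1/ₙ n ℚ.* B ≡ s ℚ.* a ℚ.+ N ℚ.* w ℚ.* f
  1/n*B≡s*a+N*w*f = begin
    1/ₙ n ℚ.* B                                   ≡⟨ sym (ℚP.*-identityʳ (1/ₙ n ℚ.* B)) ⟩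
    1/ₙ n ℚ.* B ℚ.* 1ℚ                            ≡⟨ cong (1/ₙ n ℚ.* B ℚ.*_) (sym F*f≡1) ⟩
    1/ₙ n ℚ.* B ℚ.* (F ℚ.* f)
      ≡⟨ solve 4 (λ i B F f → i :* B :* (F :* f) := i :* (B :* F) :* f) refl (1/ₙ n) B F f ⟩
    1/ₙ n ℚ.* (B ℚ.* F) ℚ.* f                     ≡⟨ cong (λ x → 1/ₙ n ℚ.* x ℚ.* f) B*F≡N*[sK+Nw] ⟩
    1/ₙ n ℚ.* (N ℚ.* (s ℚ.* K ℚ.+ N ℚ.* w)) ℚ.* f
      ≡⟨ solve 6 (λ i N s K w f → i :* (N :* (s :* K :+ N :* w)) :* f := (i :* N) :* (s :* (K :* f) :+ N :* w :* f))
           refl (1/ₙ n) N s K w f ⟩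
    (1/ₙ n ℚ.* N) ℚ.* (s ℚ.* (K ℚ.* f) ℚ.+ N ℚ.* w ℚ.* f)
      ≡⟨ cong₂ (λ u v → u ℚ.* (s ℚ.* v ℚ.+ N ℚ.* w ℚ.* f)) (1/ₙd*d≡1 n) K*f≡a ⟩
    1ℚ ℚ.* (s ℚ.* a ℚ.+ N ℚ.* w ℚ.* f)            ≡⟨ ℚP.*-identityˡ (s ℚ.* a ℚ.+ N ℚ.* w ℚ.* f) ⟩
    s ℚ.* a ℚ.+ N ℚ.* w ℚ.* f                     ∎

average-x^-minus-bernoulli : ∀ n .{{_ : NonZero n}} m →
  1/ₙ n ℚ.* Σ< n (λ x → ℕ→ℚ x ^ℚ m) ℚ.- bernoulli m
    ≡ Σ≤ m (λ k → (1/ₙ n ℚ.* ℕ→ℚ (n C suc k) ℚ.- sign k ℚ.* 1/ₙ suc k) ℚ.* Δ^ k (λ x → ℕ→ℚ x ^ℚ m) 0)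
average-x^-minus-bernoulli n m = begin
  1/ₙ n ℚ.* Σ< n f ℚ.- bernoulli m
    ≡⟨ cong₂ (λ u v → 1/ₙ n ℚ.* u ℚ.- v) (trans (Σ<-newton n f) truncate)
             (Σ<-cong (suc m) (λ k → cong (1/ₙ suc k ℚ.*_) (altBinomSum≡sign*Δ^ k f))) ⟩
  1/ₙ n ℚ.* Σ≤ m g ℚ.- Σ≤ m (λ k → 1/ₙ suc k ℚ.* (sign k ℚ.* a k))
    ≡⟨ cong (ℚ._- Σ≤ m (λ k → 1/ₙ suc k ℚ.* (sign k ℚ.* a k))) (sym (Σ<-*ˡ (suc m) (1/ₙ n) g)) ⟩
  Σ≤ m (λ k → 1/ₙ n ℚ.* g k) ℚ.- Σ≤ m (λ k → 1/ₙ suc k ℚ.* (sign k ℚ.* a k))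
    ≡⟨ sym (Σ<-sub (suc m) _ _) ⟩
  Σ≤ m (λ k → 1/ₙ n ℚ.* g k ℚ.- 1/ₙ suc k ℚ.* (sign k ℚ.* a k))
    ≡⟨ Σ<-cong (suc m) (λ k → collect (1/ₙ n) (ℕ→ℚ (n C suc k)) (sign k) (1/ₙ suc k) (a k)) ⟩
  Σ≤ m (λ k → (1/ₙ n ℚ.* ℕ→ℚ (n C suc k) ℚ.- sign k ℚ.* 1/ₙ suc k) ℚ.* a k)
    ∎
  where
  f : ℕ → ℚ
  f x = ℕ→ℚ x ^ℚ m
  a : ℕ → ℚ
  a k = Δ^ k f 0
  g : ℕ → ℚ
  g k = ℕ→ℚ (n C suc k) ℚ.* a k
  collect : ∀ i c s j x → i ℚ.* (c ℚ.* x) ℚ.- j ℚ.* (s ℚ.* x) ≡ (i ℚ.* c ℚ.- s ℚ.* j) ℚ.* x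
  collect = solve 5 (λ i c s j x → i :* (c :* x) :- j :* (s :* x) := (i :* c :- s :* j) :* x) refl
  truncate : Σ< n g ≡ Σ≤ m g
  truncate = [ (λ 1+m≤n → Σ<-truncate g (ℕP.≤⇒≤′ 1+m≤n) beyond-degree)
             , (λ n≤1+m → sym (Σ<-truncate g (ℕP.≤⇒≤′ n≤1+m) beyond-n)) ]′ (ℕP.≤-total (suc m) n)
    where
    beyond-degree : ∀ k → suc m ≤ k → g k ≡ 0ℚ
    beyond-degree k m<k = trans (cong (ℕ→ℚ (n C suc k) ℚ.*_) (Degree≤⇒Δ^≡0 m f (Degree≤-^ m) m<k 0))
                                (ℚP.*-zeroʳ (ℕ→ℚ (n C suc k)))
    beyond-n : ∀ k → n ≤ k → g k ≡ 0ℚ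
    beyond-n k n≤k = trans (cong (λ c → ℕ→ℚ c ℚ.* a k) (n<k⇒nCk≡0 (s≤s n≤k))) (ℚP.*-zeroˡ (a k))

-- p-adic limits

Eventually : (ℕ → Set) → Set
Eventually P = ∃ λ N₀ → ∀ N → N₀ ≤ N → P N

eventually-map : ∀ {P Q : ℕ → Set} → (∀ N → P N → Q N) → Eventually P → Eventually Q
eventually-map P⇒Q (N₀ , ev) = N₀ , λ N N₀≤N → P⇒Q N (ev N N₀≤N)

eventually-× : ∀ {P Q : ℕ → Set} → Eventually P → Eventually Q → Eventually (λ N → P N × Q N)
eventually-× (N₁ , ev₁) (N₂ , ev₂) = N₁ ℕ.⊔ N₂ , λ N N₁⊔N₂≤N →
  ev₁ N (ℕP.≤-trans (ℕP.m≤m⊔n N₁ N₂) N₁⊔N₂≤N) , ev₂ N (ℕP.≤-trans (ℕP.m≤n⊔m N₁ N₂) N₁⊔N₂≤N)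

eventually-∀< : ∀ n {P : ℕ → ℕ → Set} → (∀ k → k < n → Eventually (P k)) → Eventually (λ N → ∀ k → k < n → P k N)
eventually-∀< zero    ev = 0 , λ _ _ _ ()
eventually-∀< (suc n) {P} ev =
  eventually-map combine (eventually-× (eventually-∀< n (λ k k<n → ev k (ℕP.m<n⇒m<1+n k<n))) (ev n ℕP.≤-refl))
  where
  combine : ∀ N → (∀ k → k < n → P k N) × P n N → ∀ k → k < suc n → P k N
  combine _ (below , at) k k<1+n with ℕP.m<1+n⇒m<n∨m≡n k<1+n
  ... | inj₁ k<n  = below k k<n
  ... | inj₂ refl = at

volkenbornSum≡ : ∀ {p} (pp : Prime p) f N → volkenbornSum p pp f N ≡ invPow p {{prime⇒nonZero pp}} N ℚ.* Σ< (p ^ N) f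
volkenbornSum≡ (prime _) f N = refl

module _ {p : ℕ} (pp : Prime p) where

  private instance
    p≢0 : NonZero p
    p≢0 = prime⇒nonZero pp

  p∤1 : ¬ p ∣ 1
  p∤1 p∣1 = ℕP.<-irrefl (sym (∣1⇒≡1 p∣1)) (ℕ.nonTrivial⇒n>1 p {{prime⇒nonTrivial pp}})

  -- q ∈ p^e ℤ₍ₚ₎: multiplying q by some integer prime to p gives p^e times an integer.
  infix 4 p^_∣ₗ_
  record p^_∣ₗ_ (e : ℕ) (q : ℚ) : Set where
    constructor mk∣ₗ
    field
      unit       : ℕ
      p∤unit     : ¬ p ∣ unit
      quotient   : ℚ
      quotient∈ℤ : IsInteger quotient
      equation   : q ℚ.* ℕ→ℚ unit ≡ ℕ→ℚ (p ^ e) ℚ.* quotient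

  ∣ₗ-0 : ∀ {e} → p^ e ∣ₗ 0ℚ
  ∣ₗ-0 {e} = mk∣ₗ 1 p∤1 0ℚ (isInteger-ℕ 0) (trans (ℚP.*-zeroˡ (ℕ→ℚ 1)) (sym (ℚP.*-zeroʳ (ℕ→ℚ (p ^ e)))))

  ∣ₗ-+ : ∀ {e q r} → p^ e ∣ₗ q → p^ e ∣ₗ r → p^ e ∣ₗ q ℚ.+ r
  ∣ₗ-+ {e} {q} {r} (mk∣ₗ d₁ p∤d₁ w₁ w₁∈ℤ eq₁) (mk∣ₗ d₂ p∤d₂ w₂ w₂∈ℤ eq₂) =
    mk∣ₗ (d₁ * d₂) p∤d₁d₂ (w₁ ℚ.* D₂ ℚ.+ w₂ ℚ.* D₁)
      (isInteger-+ (isInteger-* w₁∈ℤ (isInteger-ℕ d₂)) (isInteger-* w₂∈ℤ (isInteger-ℕ d₁))) (begin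
      (q ℚ.+ r) ℚ.* ℕ→ℚ (d₁ * d₂)              ≡⟨ cong ((q ℚ.+ r) ℚ.*_) (ℕ→ℚ-homo-* d₁ d₂) ⟩
      (q ℚ.+ r) ℚ.* (D₁ ℚ.* D₂)                ≡⟨ distrib q r D₁ D₂ ⟩
      q ℚ.* D₁ ℚ.* D₂ ℚ.+ r ℚ.* D₂ ℚ.* D₁      ≡⟨ cong₂ (λ u v → u ℚ.* D₂ ℚ.+ v ℚ.* D₁) eq₁ eq₂ ⟩
      P ℚ.* w₁ ℚ.* D₂ ℚ.+ P ℚ.* w₂ ℚ.* D₁      ≡⟨ factor P w₁ w₂ D₁ D₂ ⟩
      P ℚ.* (w₁ ℚ.* D₂ ℚ.+ w₂ ℚ.* D₁)          ∎)
    where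
    D₁ = ℕ→ℚ d₁
    D₂ = ℕ→ℚ d₂
    P  = ℕ→ℚ (p ^ e)
    p∤d₁d₂ : ¬ p ∣ d₁ * d₂
    p∤d₁d₂ p∣d₁d₂ = [ p∤d₁ , p∤d₂ ]′ (euclidsLemma d₁ d₂ pp p∣d₁d₂)
    distrib : ∀ q r a b → (q ℚ.+ r) ℚ.* (a ℚ.* b) ≡ q ℚ.* a ℚ.* b ℚ.+ r ℚ.* b ℚ.* a
    distrib = solve 4 (λ q r a b → (q :+ r) :* (a :* b) := q :* a :* b :+ r :* b :* a) refl
    factor : ∀ P x y a b → P ℚ.* x ℚ.* b ℚ.+ P ℚ.* y ℚ.* a ≡ P ℚ.* (x ℚ.* b ℚ.+ y ℚ.* a)
    factor = solve 5 (λ P x y a b → P :* x :* b :+ P :* y :* a := P :* (x :* b :+ y :* a)) refl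

  ∣ₗ-*ˡ : ∀ {e c q} → IsInteger c → p^ e ∣ₗ q → p^ e ∣ₗ c ℚ.* q
  ∣ₗ-*ˡ {e} {c} {q} c∈ℤ (mk∣ₗ d p∤d w w∈ℤ eq) = mk∣ₗ d p∤d (c ℚ.* w) (isInteger-* c∈ℤ w∈ℤ) (begin
    c ℚ.* q ℚ.* ℕ→ℚ d             ≡⟨ ℚP.*-assoc c q (ℕ→ℚ d) ⟩
    c ℚ.* (q ℚ.* ℕ→ℚ d)           ≡⟨ cong (c ℚ.*_) eq ⟩
    c ℚ.* (ℕ→ℚ (p ^ e) ℚ.* w)     ≡⟨ solve 3 (λ c P w → c :* (P :* w) := P :* (c :* w)) refl c (ℕ→ℚ (p ^ e)) w ⟩
    ℕ→ℚ (p ^ e) ℚ.* (c ℚ.* w)     ∎)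

  ∣ₗ-sub : ∀ {e q r} → p^ e ∣ₗ q → p^ e ∣ₗ r → p^ e ∣ₗ q ℚ.- r
  ∣ₗ-sub {e} {q} {r} q∣ r∣ = ∣ₗ-+ q∣ (subst (p^ e ∣ₗ_) (-1*r≡-r r) (∣ₗ-*ˡ (isInteger-neg (isInteger-ℕ 1)) r∣))
    where
    -1*r≡-r : ∀ r → (- 1ℚ) ℚ.* r ≡ - r
    -1*r≡-r = solve 1 (λ r → con (- 1ℚ) :* r := :- r) refl

  ∣ₗ-Σ : ∀ {e} n (f : ℕ → ℚ) → (∀ k → k < n → p^ e ∣ₗ f k) → p^ e ∣ₗ Σ< n f
  ∣ₗ-Σ zero    f _  = ∣ₗ-0
  ∣ₗ-Σ (suc n) f f∣ = ∣ₗ-+ (∣ₗ-Σ n f (λ k k<n → f∣ k (ℕP.m<n⇒m<1+n k<n))) (f∣ n ℕP.≤-refl)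

  p^e∣m*d⇒p^e∣m : ∀ e {m d} → ¬ p ∣ d → p ^ e ∣ m * d → p ^ e ∣ m
  p^e∣m*d⇒p^e∣m zero    {m} _   _ = 1∣ m
  p^e∣m*d⇒p^e∣m (suc e) {m} {d} p∤d p^[1+e]∣m*d
    with euclidsLemma m d pp (∣-trans (m∣m*n (p ^ e)) p^[1+e]∣m*d)
  ... | inj₂ p∣d = ⊥-elim (p∤d p∣d)
  ... | inj₁ (divides m′ refl) = subst (p ^ suc e ∣_) (ℕP.*-comm p m′)
          (*-monoʳ-∣ p (p^e∣m*d⇒p^e∣m e p∤d (*-cancelˡ-∣ p (subst (p ^ suc e ∣_) (reassoc m′ p d) p^[1+e]∣m*d))))
    where
    reassoc : ∀ m p d → m * p * d ≡ p * (m * d)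
    reassoc = ℕ-solve-∀

  ∣ₗ⇒padicValGE : ∀ {e q} → p^ e ∣ₗ q → padicValGE p e q
  ∣ₗ⇒padicValGE {e} {q} (mk∣ₗ d p∤d _ (z , refl) eq) =
    p^e∣m*d⇒p^e∣m e p∤d (divides (ℤ.∣ z ∣ * ℚ.↧ₙ q) (begin
      ℤ.∣ ℚ.↥ q ∣ * d                            ≡⟨ sym (ℤP.abs-* (ℚ.↥ q) (+ d)) ⟩
      ℤ.∣ ℚ.↥ q ℤ.* + d ∣
        ≡⟨ cong ℤ.∣_∣ (ℤ→ℚ-injective {ℚ.↥ q ℤ.* + d} {+ (p ^ e) ℤ.* z ℤ.* + ℚ.↧ₙ q} ↥q*d≡p^e*z*↧q) ⟩
      ℤ.∣ + (p ^ e) ℤ.* z ℤ.* + ℚ.↧ₙ q ∣         ≡⟨ ℤP.abs-* (+ (p ^ e) ℤ.* z) (+ ℚ.↧ₙ q) ⟩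
      ℤ.∣ + (p ^ e) ℤ.* z ∣ * ℚ.↧ₙ q             ≡⟨ cong (_* ℚ.↧ₙ q) (ℤP.abs-* (+ (p ^ e)) z) ⟩
      p ^ e * ℤ.∣ z ∣ * ℚ.↧ₙ q                   ≡⟨ rotate (p ^ e) ℤ.∣ z ∣ (ℚ.↧ₙ q) ⟩
      ℤ.∣ z ∣ * ℚ.↧ₙ q * p ^ e                   ∎))
    where
    rotate : ∀ a b c → a * b * c ≡ b * c * a
    rotate = ℕ-solve-∀
    ↥q*d≡p^e*z*↧q : ℤ→ℚ (ℚ.↥ q ℤ.* + d) ≡ ℤ→ℚ (+ (p ^ e) ℤ.* z ℤ.* + ℚ.↧ₙ q)
    ↥q*d≡p^e*z*↧q = begin
      ℤ→ℚ (ℚ.↥ q ℤ.* + d)                                   ≡⟨ ℤ→ℚ-homo-* (ℚ.↥ q) (+ d) ⟩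
      ℤ→ℚ (ℚ.↥ q) ℚ.* ℕ→ℚ d                                 ≡⟨ cong (ℚ._* ℕ→ℚ d) (↥q≡q*↧q q) ⟩
      q ℚ.* ℕ→ℚ (ℚ.↧ₙ q) ℚ.* ℕ→ℚ d                          ≡⟨ swap q (ℕ→ℚ (ℚ.↧ₙ q)) (ℕ→ℚ d) ⟩
      q ℚ.* ℕ→ℚ d ℚ.* ℕ→ℚ (ℚ.↧ₙ q)                          ≡⟨ cong (ℚ._* ℕ→ℚ (ℚ.↧ₙ q)) eq ⟩
      ℕ→ℚ (p ^ e) ℚ.* ℤ→ℚ z ℚ.* ℕ→ℚ (ℚ.↧ₙ q)
        ≡⟨ sym (cong (ℚ._* ℕ→ℚ (ℚ.↧ₙ q)) (ℤ→ℚ-homo-* (+ (p ^ e)) z)) ⟩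
      ℤ→ℚ (+ (p ^ e) ℤ.* z) ℚ.* ℕ→ℚ (ℚ.↧ₙ q)                ≡⟨ sym (ℤ→ℚ-homo-* (+ (p ^ e) ℤ.* z) (+ ℚ.↧ₙ q)) ⟩
      ℤ→ℚ (+ (p ^ e) ℤ.* z ℤ.* + ℚ.↧ₙ q)                    ∎
      where
      swap : ∀ a b c → a ℚ.* b ℚ.* c ≡ a ℚ.* c ℚ.* b
      swap = solve 3 (λ a b c → a :* b :* c := a :* c :* b) refl

  split-p-power : ∀ m → NonZero m → ∃ λ v → ∃ λ d → ¬ p ∣ d × m ≡ p ^ v * d
  split-p-power = <-rec _ split
    where
    split : ∀ m → (∀ {m′} → m′ < m → NonZero m′ → ∃ λ v → ∃ λ d → ¬ p ∣ d × m′ ≡ p ^ v * d) →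
            NonZero m → ∃ λ v → ∃ λ d → ¬ p ∣ d × m ≡ p ^ v * d
    split m rec m≢0 with p ∣? m
    ... | no  p∤m = 0 , m , p∤m , sym (ℕP.*-identityˡ m)
    ... | yes (divides m′ refl) with rec m′<m′*p m′≢0
      where
      m′≢0 : NonZero m′
      m′≢0 = ℕP.m*n≢0⇒m≢0 m′ {{m≢0}}
      m′<m′*p : m′ < m′ * p
      m′<m′*p = ℕP.m<m*n m′ p {{m′≢0}} (ℕ.nonTrivial⇒n>1 p {{prime⇒nonTrivial pp}})
    ...   | v , d , p∤d , m′≡p^v*d = suc v , d , p∤d , (begin
      m′ * p            ≡⟨ cong (_* p) m′≡p^v*d ⟩
      p ^ v * d * p     ≡⟨ rotate (p ^ v) d p ⟩
      p * p ^ v * d     ∎)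
      where
      rotate : ∀ a b c → a * b * c ≡ c * a * b
      rotate = ℕ-solve-∀

  eventually-∣ₗ-p^N : ∀ c e → Eventually (λ N → ∀ w → IsInteger w → p^ e ∣ₗ c ℚ.* ℕ→ℚ (p ^ N) ℚ.* w)
  eventually-∣ₗ-p^N c e = e + v , λ N e+v≤N w w∈ℤ →
    mk∣ₗ d p∤d (ℤ→ℚ (ℚ.↥ c) ℚ.* ℕ→ℚ (p ^ (N ∸ (e + v))) ℚ.* w)
      (isInteger-* (isInteger-* (ℚ.↥ c , refl) (isInteger-ℕ (p ^ (N ∸ (e + v))))) w∈ℤ) (equation N e+v≤N w)
    where
    split = split-p-power (ℚ.↧ₙ c) _
    v = proj₁ split
    d = proj₁ (proj₂ split)
    p∤d = proj₁ (proj₂ (proj₂ split))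
    ↧c≡p^v*d = proj₂ (proj₂ (proj₂ split))
    equation : ∀ N → e + v ≤ N → ∀ w → c ℚ.* ℕ→ℚ (p ^ N) ℚ.* w ℚ.* ℕ→ℚ d
             ≡ ℕ→ℚ (p ^ e) ℚ.* (ℤ→ℚ (ℚ.↥ c) ℚ.* ℕ→ℚ (p ^ (N ∸ (e + v))) ℚ.* w)
    equation N e+v≤N w = begin
      c ℚ.* ℕ→ℚ (p ^ N) ℚ.* w ℚ.* D
        ≡⟨ cong (λ x → c ℚ.* x ℚ.* w ℚ.* D) p^N≡p^e*p^v*p^t ⟩
      c ℚ.* (P ℚ.* V ℚ.* T) ℚ.* w ℚ.* D
        ≡⟨ solve 6 (λ c P V T w D → c :* (P :* V :* T) :* w :* D := P :* (c :* (V :* D) :* T :* w)) refl c P V T w D ⟩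
      P ℚ.* (c ℚ.* (V ℚ.* D) ℚ.* T ℚ.* w)
        ≡⟨ cong (λ x → P ℚ.* (c ℚ.* x ℚ.* T ℚ.* w)) V*D≡↧c ⟩
      P ℚ.* (c ℚ.* ℕ→ℚ (ℚ.↧ₙ c) ℚ.* T ℚ.* w)
        ≡⟨ cong (λ x → P ℚ.* (x ℚ.* T ℚ.* w)) (sym (↥q≡q*↧q c)) ⟩
      P ℚ.* (ℤ→ℚ (ℚ.↥ c) ℚ.* T ℚ.* w)
        ∎
      where
      t = N ∸ (e + v)
      P = ℕ→ℚ (p ^ e)
      V = ℕ→ℚ (p ^ v)
      T = ℕ→ℚ (p ^ t)
      D = ℕ→ℚ d
      p^N≡p^e*p^v*p^t : ℕ→ℚ (p ^ N) ≡ P ℚ.* V ℚ.* T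
      p^N≡p^e*p^v*p^t = begin
        ℕ→ℚ (p ^ N)                    ≡⟨ cong (λ x → ℕ→ℚ (p ^ x)) (sym (ℕP.m+[n∸m]≡n e+v≤N)) ⟩
        ℕ→ℚ (p ^ (e + v + t))          ≡⟨ cong ℕ→ℚ (ℕP.^-distribˡ-+-* p (e + v) t) ⟩
        ℕ→ℚ (p ^ (e + v) * p ^ t)      ≡⟨ cong (λ x → ℕ→ℚ (x * p ^ t)) (ℕP.^-distribˡ-+-* p e v) ⟩
        ℕ→ℚ (p ^ e * p ^ v * p ^ t)    ≡⟨ ℕ→ℚ-homo-* (p ^ e * p ^ v) (p ^ t) ⟩
        ℕ→ℚ (p ^ e * p ^ v) ℚ.* T      ≡⟨ cong (ℚ._* T) (ℕ→ℚ-homo-* (p ^ e) (p ^ v)) ⟩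
        P ℚ.* V ℚ.* T                  ∎
      V*D≡↧c : V ℚ.* D ≡ ℕ→ℚ (ℚ.↧ₙ c)
      V*D≡↧c = trans (sym (ℕ→ℚ-homo-* (p ^ v) d)) (cong ℕ→ℚ (sym ↧c≡p^v*d))

  infix 4 _⟶_
  _⟶_ : (ℕ → ℚ) → ℚ → Set
  a ⟶ L = ∀ e → Eventually (λ N → p^ e ∣ₗ a N ℚ.- L)

  ⟶-cong : ∀ {a b : ℕ → ℚ} {L M} → (∀ N → a N ≡ b N) → L ≡ M → a ⟶ L → b ⟶ M
  ⟶-cong {L = L} a≗b refl a⟶L e = eventually-map (λ N → subst (λ x → p^ e ∣ₗ x ℚ.- L) (a≗b N)) (a⟶L e)

  ⟶-sub : ∀ {a b : ℕ → ℚ} {L M} → a ⟶ L → b ⟶ M → (λ N → a N ℚ.- b N) ⟶ L ℚ.- M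
  ⟶-sub {a} {b} {L} {M} a⟶L b⟶M e =
    eventually-map (λ N (a∣ , b∣) → subst (p^ e ∣ₗ_) (regroup (a N) (b N) L M) (∣ₗ-sub a∣ b∣))
                   (eventually-× (a⟶L e) (b⟶M e))
    where
    regroup : ∀ a b L M → (a ℚ.- L) ℚ.- (b ℚ.- M) ≡ (a ℚ.- b) ℚ.- (L ℚ.- M)
    regroup = solve 4 (λ a b L M → (a :- L) :- (b :- M) := (a :- b) :- (L :- M)) refl

  ⟶-*ˡ : ∀ {c} {a : ℕ → ℚ} {L} → IsInteger c → a ⟶ L → (λ N → c ℚ.* a N) ⟶ c ℚ.* L
  ⟶-*ˡ {c} {a} {L} c∈ℤ a⟶L e =
    eventually-map (λ N a∣ → subst (p^ e ∣ₗ_) (distrib c (a N) L) (∣ₗ-*ˡ c∈ℤ a∣)) (a⟶L e)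
    where
    distrib : ∀ c a L → c ℚ.* (a ℚ.- L) ≡ c ℚ.* a ℚ.- c ℚ.* L
    distrib = solve 3 (λ c a L → c :* (a :- L) := c :* a :- c :* L) refl

  -- Volkenborn integrals

  HasIntegral : (ℕ → ℚ) → ℚ → Set
  HasIntegral f L = volkenbornSum p pp f ⟶ L

  HasIntegral⇒VolkenbornIntegral : ∀ {f L} → HasIntegral f L → VolkenbornIntegral p pp f L
  HasIntegral⇒VolkenbornIntegral ∫f e = eventually-map (λ _ → ∣ₗ⇒padicValGE) (∫f e)

  hasIntegral-cong : ∀ {f g : ℕ → ℚ} {L M} → (∀ x → f x ≡ g x) → L ≡ M → HasIntegral f L → HasIntegral g M
  hasIntegral-cong {f} {g} f≗g = ⟶-cong {volkenbornSum p pp f} {volkenbornSum p pp g} λ N → begin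
    volkenbornSum p pp f N                                  ≡⟨ volkenbornSum≡ pp f N ⟩
    invPow p N ℚ.* Σ< (p ^ N) f          ≡⟨ cong (invPow p N ℚ.*_) (Σ<-cong (p ^ N) f≗g) ⟩
    invPow p N ℚ.* Σ< (p ^ N) g          ≡⟨ sym (volkenbornSum≡ pp g N) ⟩
    volkenbornSum p pp g N                                  ∎

  hasIntegral-sub : ∀ {f g : ℕ → ℚ} {L M} →
                    HasIntegral f L → HasIntegral g M → HasIntegral (λ x → f x ℚ.- g x) (L ℚ.- M)
  hasIntegral-sub {f} {g} ∫f ∫g = ⟶-cong (λ N → begin
    volkenbornSum p pp f N ℚ.- volkenbornSum p pp g N
      ≡⟨ cong₂ ℚ._-_ (volkenbornSum≡ pp f N) (volkenbornSum≡ pp g N) ⟩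
    i N ℚ.* Σ< (p ^ N) f ℚ.- i N ℚ.* Σ< (p ^ N) g       ≡⟨ factor (i N) (Σ< (p ^ N) f) (Σ< (p ^ N) g) ⟩
    i N ℚ.* (Σ< (p ^ N) f ℚ.- Σ< (p ^ N) g)             ≡⟨ cong (i N ℚ.*_) (sym (Σ<-sub (p ^ N) f g)) ⟩
    i N ℚ.* Σ< (p ^ N) (λ x → f x ℚ.- g x)              ≡⟨ sym (volkenbornSum≡ pp (λ x → f x ℚ.- g x) N) ⟩
    volkenbornSum p pp (λ x → f x ℚ.- g x) N            ∎)
    refl (⟶-sub {volkenbornSum p pp f} {volkenbornSum p pp g} ∫f ∫g)
    where
    i = invPow p
    factor : ∀ i a b → i ℚ.* a ℚ.- i ℚ.* b ≡ i ℚ.* (a ℚ.- b)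
    factor = solve 3 (λ i a b → i :* a :- i :* b := i :* (a :- b)) refl

  hasIntegral-*ˡ : ∀ {c} {f : ℕ → ℚ} {L} → IsInteger c → HasIntegral f L → HasIntegral (λ x → c ℚ.* f x) (c ℚ.* L)
  hasIntegral-*ˡ {c} {f} c∈ℤ ∫f = ⟶-cong (λ N → begin
    c ℚ.* volkenbornSum p pp f N               ≡⟨ cong (c ℚ.*_) (volkenbornSum≡ pp f N) ⟩
    c ℚ.* (i N ℚ.* Σ< (p ^ N) f)
      ≡⟨ solve 3 (λ c i a → c :* (i :* a) := i :* (c :* a)) refl c (i N) (Σ< (p ^ N) f) ⟩
    i N ℚ.* (c ℚ.* Σ< (p ^ N) f)               ≡⟨ cong (i N ℚ.*_) (sym (Σ<-*ˡ (p ^ N) c f)) ⟩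
    i N ℚ.* Σ< (p ^ N) (λ x → c ℚ.* f x)       ≡⟨ sym (volkenbornSum≡ pp (λ x → c ℚ.* f x) N) ⟩
    volkenbornSum p pp (λ x → c ℚ.* f x) N     ∎) refl (⟶-*ˡ {a = volkenbornSum p pp f} c∈ℤ ∫f)
    where
    i = invPow p

  hasIntegral-x^ : ∀ m → HasIntegral (λ x → ℕ→ℚ x ^ℚ m) (bernoulli m)
  hasIntegral-x^ m e = eventually-map sum-small (eventually-∀< (suc m) (λ k _ → term-small k))
    where
    f : ℕ → ℚ
    f x = ℕ→ℚ x ^ℚ m
    term : ℕ → ℕ → ℚ
    term N k = (invPow p N ℚ.* ℕ→ℚ (p ^ N C suc k) ℚ.- sign k ℚ.* 1/ₙ suc k) ℚ.* Δ^ k f 0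
    term-small : ∀ k → Eventually (λ N → p^ e ∣ₗ term N k)
    term-small k = eventually-map small (eventually-∣ₗ-p^N (Δ^ k f 0 ℚ.* 1/[ suc k !]) e)
      where
      small : ∀ N → (∀ w → IsInteger w → p^ e ∣ₗ Δ^ k f 0 ℚ.* 1/[ suc k !] ℚ.* ℕ→ℚ (p ^ N) ℚ.* w) → p^ e ∣ₗ term N k
      small N ∣ₗ-multiple = subst (p^ e ∣ₗ_) (begin
        Δ^ k f 0 ℚ.* 1/[ suc k !] ℚ.* ℕ→ℚ (p ^ N) ℚ.* w
          ≡⟨ solve 4 (λ a f n w → a :* f :* n :* w := n :* w :* f :* a) refl (Δ^ k f 0) 1/[ suc k !] (ℕ→ℚ (p ^ N)) w ⟩
        ℕ→ℚ (p ^ N) ℚ.* w ℚ.* 1/[ suc k !] ℚ.* Δ^ k f 0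
          ≡⟨ cong (ℚ._* Δ^ k f 0) (sym ratio≡) ⟩
        term N k
          ∎) (∣ₗ-multiple w w∈ℤ)
        where
        ratio = binomial-ratio (p ^ N) {{ℕP.m^n≢0 p N}} k
        w = proj₁ ratio
        w∈ℤ = proj₁ (proj₂ ratio)
        ratio≡ = proj₂ (proj₂ ratio)
    sum-small : ∀ N → (∀ k → k < suc m → p^ e ∣ₗ term N k) → p^ e ∣ₗ volkenbornSum p pp f N ℚ.- bernoulli m
    sum-small N terms-small = subst (p^ e ∣ₗ_)
      (sym (trans (cong (ℚ._- bernoulli m) (volkenbornSum≡ pp f N))
                  (average-x^-minus-bernoulli (p ^ N) {{ℕP.m^n≢0 p N}} m)))
      (∣ₗ-Σ (suc m) (term N) terms-small)

  hasIntegral-x^[1-x]^ : ∀ D K → HasIntegral (λ x → ℕ→ℚ x ^ℚ K ℚ.* (1ℚ ℚ.- ℕ→ℚ x) ^ℚ D)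
                                             (altBinomSum D (λ l → bernoulli (K + l)))
  hasIntegral-x^[1-x]^ zero    K =
    hasIntegral-cong (λ x → sym (ℚP.*-identityʳ (ℕ→ℚ x ^ℚ K))) B[K]≡Σ (hasIntegral-x^ K)
    where
    B[K]≡Σ : bernoulli K ≡ altBinomSum 0 (λ l → bernoulli (K + l))
    B[K]≡Σ = sym (trans (ℚP.+-identityˡ _) (trans (ℚP.*-identityˡ _) (cong bernoulli (ℕP.+-identityʳ K))))
  hasIntegral-x^[1-x]^ (suc D) K =
    hasIntegral-cong peel Σ-peel (hasIntegral-sub (hasIntegral-x^[1-x]^ D K) (hasIntegral-x^[1-x]^ D (suc K)))
    where
    peel : ∀ x → ℕ→ℚ x ^ℚ K ℚ.* (1ℚ ℚ.- ℕ→ℚ x) ^ℚ D ℚ.- ℕ→ℚ x ^ℚ suc K ℚ.* (1ℚ ℚ.- ℕ→ℚ x) ^ℚ D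
               ≡ ℕ→ℚ x ^ℚ K ℚ.* (1ℚ ℚ.- ℕ→ℚ x) ^ℚ suc D
    peel x = solve 3 (λ x a b → a :* b :- (x :* a) :* b := a :* ((con 1ℚ :- x) :* b)) refl
               (ℕ→ℚ x) (ℕ→ℚ x ^ℚ K) ((1ℚ ℚ.- ℕ→ℚ x) ^ℚ D)
    Σ-peel : altBinomSum D (λ l → bernoulli (K + l)) ℚ.- altBinomSum D (λ l → bernoulli (suc K + l))
           ≡ altBinomSum (suc D) (λ l → bernoulli (K + l))
    Σ-peel = sym (trans (altBinomSum-suc D (λ l → bernoulli (K + l)))
      (cong (ℚ._-_ (altBinomSum D (λ l → bernoulli (K + l))))
        (Σ<-cong (suc D) (λ l → cong (λ j → sign l ℚ.* ℕ→ℚ (D C l) ℚ.* bernoulli j) (ℕP.+-suc K l)))))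

-- Products of Bernstein polynomials

ΣFinℕ-cong : ∀ s {f g : Fin s → ℕ} → (∀ i → f i ≡ g i) → ΣFinℕ s f ≡ ΣFinℕ s g
ΣFinℕ-cong zero    f≗g = refl
ΣFinℕ-cong (suc s) f≗g = cong₂ _+_ (f≗g Fin.zero) (ΣFinℕ-cong s (f≗g ∘ Fin.suc))

ΣFinℕ-+ : ∀ s (f g : Fin s → ℕ) → ΣFinℕ s (λ i → f i + g i) ≡ ΣFinℕ s f + ΣFinℕ s g
ΣFinℕ-+ zero    f g = refl
ΣFinℕ-+ (suc s) f g = trans (cong (_+_ (f Fin.zero + g Fin.zero)) (ΣFinℕ-+ s (f ∘ Fin.suc) (g ∘ Fin.suc)))
  (shuffle (f Fin.zero) (g Fin.zero) (ΣFinℕ s (f ∘ Fin.suc)) (ΣFinℕ s (g ∘ Fin.suc)))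
  where
  shuffle : ∀ a b c d → a + b + (c + d) ≡ a + c + (b + d)
  shuffle = ℕ-solve-∀

ΣFinℕ-∸ : ∀ s (f g : Fin s → ℕ) → (∀ i → g i ≤ f i) → ΣFinℕ s f ∸ ΣFinℕ s g ≡ ΣFinℕ s (λ i → f i ∸ g i)
ΣFinℕ-∸ s f g g≤f = begin
  ΣFinℕ s f ∸ ΣFinℕ s g
    ≡⟨ cong (_∸ ΣFinℕ s g) (trans (ΣFinℕ-cong s (λ i → sym (ℕP.m+[n∸m]≡n (g≤f i)))) (ΣFinℕ-+ s g _)) ⟩
  ΣFinℕ s g + ΣFinℕ s (λ i → f i ∸ g i) ∸ ΣFinℕ s g
    ≡⟨ ℕP.m+n∸m≡n (ΣFinℕ s g) _ ⟩
  ΣFinℕ s (λ i → f i ∸ g i)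
    ∎

ΠFinℚ-cong : ∀ s {f g : Fin s → ℚ} → (∀ i → f i ≡ g i) → ΠFinℚ s f ≡ ΠFinℚ s g
ΠFinℚ-cong zero    f≗g = refl
ΠFinℚ-cong (suc s) f≗g = cong₂ ℚ._*_ (f≗g Fin.zero) (ΠFinℚ-cong s (f≗g ∘ Fin.suc))

ΠFinℚ-monomial : ∀ s (a u v : Fin s → ℕ) X Y →
  ΠFinℚ s (λ i → ℕ→ℚ (a i) ℚ.* X ^ℚ u i ℚ.* Y ^ℚ v i)
    ≡ ℕ→ℚ (ΠFinℕ s a) ℚ.* (X ^ℚ ΣFinℕ s u ℚ.* Y ^ℚ ΣFinℕ s v)
ΠFinℚ-monomial zero    a u v X Y = solve 0 (con 1ℚ := con 1ℚ :* (con 1ℚ :* con 1ℚ)) refl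
ΠFinℚ-monomial (suc s) a u v X Y = begin
  ℕ→ℚ (a Fin.zero) ℚ.* X ^ℚ u Fin.zero ℚ.* Y ^ℚ v Fin.zero
    ℚ.* ΠFinℚ s (λ i → ℕ→ℚ (a (Fin.suc i)) ℚ.* X ^ℚ u (Fin.suc i) ℚ.* Y ^ℚ v (Fin.suc i))
    ≡⟨ cong (ℕ→ℚ (a Fin.zero) ℚ.* X ^ℚ u Fin.zero ℚ.* Y ^ℚ v Fin.zero ℚ.*_)
            (ΠFinℚ-monomial s (a ∘ Fin.suc) (u ∘ Fin.suc) (v ∘ Fin.suc) X Y) ⟩
  ℕ→ℚ (a Fin.zero) ℚ.* X ^ℚ u Fin.zero ℚ.* Y ^ℚ v Fin.zero ℚ.* (ℕ→ℚ A ℚ.* (X ^ℚ U ℚ.* Y ^ℚ V))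
    ≡⟨ solve 6 (λ a x y A X Y → a :* x :* y :* (A :* (X :* Y)) := (a :* A) :* ((x :* X) :* (y :* Y))) refl
         (ℕ→ℚ (a Fin.zero)) (X ^ℚ u Fin.zero) (Y ^ℚ v Fin.zero) (ℕ→ℚ A) (X ^ℚ U) (Y ^ℚ V) ⟩
  (ℕ→ℚ (a Fin.zero) ℚ.* ℕ→ℚ A) ℚ.* ((X ^ℚ u Fin.zero ℚ.* X ^ℚ U) ℚ.* (Y ^ℚ v Fin.zero ℚ.* Y ^ℚ V))
    ≡⟨ sym (cong₂ ℚ._*_ (ℕ→ℚ-homo-* (a Fin.zero) A)
                        (cong₂ ℚ._*_ (^ℚ-homo-+ X (u Fin.zero) U) (^ℚ-homo-+ Y (v Fin.zero) V))) ⟩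
  ℕ→ℚ (a Fin.zero * A) ℚ.* (X ^ℚ (u Fin.zero + U) ℚ.* Y ^ℚ (v Fin.zero + V))
    ∎
  where
  A = ΠFinℕ s (a ∘ Fin.suc)
  U = ΣFinℕ s (u ∘ Fin.suc)
  V = ΣFinℕ s (v ∘ Fin.suc)

bernstein^ : ∀ k n m X →
  bernstein k n X ^ℚ m ≡ ℕ→ℚ ((n C k) ^ m) ℚ.* X ^ℚ (k * m) ℚ.* (1ℚ ℚ.- X) ^ℚ ((n ∸ k) * m)
bernstein^ k n m X = begin
  (ℕ→ℚ (n C k) ℚ.* X ^ℚ k ℚ.* (1ℚ ℚ.- X) ^ℚ (n ∸ k)) ^ℚ m
    ≡⟨ ^ℚ-distrib-* (ℕ→ℚ (n C k) ℚ.* X ^ℚ k) ((1ℚ ℚ.- X) ^ℚ (n ∸ k)) m ⟩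
  (ℕ→ℚ (n C k) ℚ.* X ^ℚ k) ^ℚ m ℚ.* ((1ℚ ℚ.- X) ^ℚ (n ∸ k)) ^ℚ m
    ≡⟨ cong₂ ℚ._*_ (^ℚ-distrib-* (ℕ→ℚ (n C k)) (X ^ℚ k) m) (^ℚ-assocʳ (1ℚ ℚ.- X) (n ∸ k) m) ⟩
  ℕ→ℚ (n C k) ^ℚ m ℚ.* (X ^ℚ k) ^ℚ m ℚ.* (1ℚ ℚ.- X) ^ℚ ((n ∸ k) * m)
    ≡⟨ cong (ℚ._* (1ℚ ℚ.- X) ^ℚ ((n ∸ k) * m)) (cong₂ ℚ._*_ (sym (ℕ→ℚ-homo-^ (n C k) m)) (^ℚ-assocʳ X k m)) ⟩
  ℕ→ℚ ((n C k) ^ m) ℚ.* X ^ℚ (k * m) ℚ.* (1ℚ ℚ.- X) ^ℚ ((n ∸ k) * m)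
    ∎

ΠFinℚ-bernstein^ : ∀ s (m k n : Fin s → ℕ) X →
  ΠFinℚ s (λ i → bernstein (k i) (n i) X ^ℚ m i)
    ≡ ℕ→ℚ (ΠFinℕ s (λ i → (n i C k i) ^ m i))
        ℚ.* (X ^ℚ ΣFinℕ s (λ i → k i * m i) ℚ.* (1ℚ ℚ.- X) ^ℚ ΣFinℕ s (λ i → (n i ∸ k i) * m i))
ΠFinℚ-bernstein^ s m k n X =
  trans (ΠFinℚ-cong s (λ i → bernstein^ (k i) (n i) (m i) X))
        (ΠFinℚ-monomial s (λ i → (n i C k i) ^ m i) (λ i → k i * m i) (λ i → (n i ∸ k i) * m i) X (1ℚ ℚ.- X))

mainTheorem6 : (p : ℕ) → (pp : Prime p) → (s : ℕ) → (m k n : Fin s → ℕ) →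
    (∀ i → 1 ≤ m i) → (∀ i → k i ≤ n i) →
    let K = ΣFinℕ s (λ i → k i * m i)
        D = ΣFinℕ s (λ i → n i * m i) ∸ K
    in VolkenbornIntegral p pp
         (λ x → ΠFinℚ s (λ i → bernstein (k i) (n i) (ℕ→ℚ x) ^ℚ m i))
         (ℕ→ℚ (ΠFinℕ s (λ i → (n i C k i) ^ m i))
           ℚ.* Σ≤ D (λ l → ((- 1ℚ) ^ℚ l) ℚ.* ℕ→ℚ (D C l) ℚ.* bernoulli (K + l)))
mainTheorem6 p pp s m k n _ k≤n =
  HasIntegral⇒VolkenbornIntegral pp (hasIntegral-cong pp integrand refl
    (hasIntegral-*ˡ pp (isInteger-ℕ binomials) (hasIntegral-x^[1-x]^ pp D K)))
  where
  K = ΣFinℕ s (λ i → k i * m i)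
  D = ΣFinℕ s (λ i → n i * m i) ∸ K
  binomials = ΠFinℕ s (λ i → (n i C k i) ^ m i)
  D≡Σ[n-k]m : D ≡ ΣFinℕ s (λ i → (n i ∸ k i) * m i)
  D≡Σ[n-k]m = trans (ΣFinℕ-∸ s (λ i → n i * m i) (λ i → k i * m i) (λ i → ℕP.*-monoˡ-≤ (m i) (k≤n i)))
                    (ΣFinℕ-cong s (λ i → sym (ℕP.*-distribʳ-∸ (m i) (n i) (k i))))
  integrand : ∀ x → ℕ→ℚ binomials ℚ.* (ℕ→ℚ x ^ℚ K ℚ.* (1ℚ ℚ.- ℕ→ℚ x) ^ℚ D)
                  ≡ ΠFinℚ s (λ i → bernstein (k i) (n i) (ℕ→ℚ x) ^ℚ m i)
  integrand x = sym (trans (ΠFinℚ-bernstein^ s m k n (ℕ→ℚ x))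
    (cong (λ e → ℕ→ℚ binomials ℚ.* (ℕ→ℚ x ^ℚ K ℚ.* (1ℚ ℚ.- ℕ→ℚ x) ^ℚ e)) (sym D≡Σ[n-k]m)))
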